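{- The following diagram commutes: $\beta: \Sigma_2 \to \Sigma^2$ along the top, $\delta: \Sigma^2 \to \Sigma_2$ on the right, $\beta: \Sigma_2 \to \Sigma^2$ along the bottom (from the lower right $\Sigma_2$ to the lower left $\Sigma^2$), and $\delta: \Sigma_2 \to \Sigma^2$ on the left; that is, $\beta \circ \delta \circ \beta = \delta$ on $\Sigma_2$.
   Context: Here $SL_2(\mathbb{N})$ denotes the set of $2\times 2$ matrices with non-negative integer entries and determinant $1$. With $R = \begin{pmatrix} 1 & 1 \\ 0 & 1\end{pmatrix}$, $$\Sigma^2 = \left\{ R \cdot \begin{pmatrix} 2 b_{11} & b_{12} \\ b_{21} & b_{22}\end{pmatrix} \;\middle|\; b_{ij} \in \mathbb{N},\ 2 b_{11} b_{22} - b_{12} b_{21} = 1 \right\},\quad \Sigma_2 = \left\{ \begin{pmatrix} b_{11} & b_{12} \\ b_{21} & 2 b_{22}\end{pmatrix} \cdot R \;\middle|\; b_{ij} \in \mathbb{N},\ 2 b_{11} b_{22} - b_{12} b_{21} = 1 \right\}.$$ The apo-syntonic conversion $\beta: \Sigma_2 \to \Sigma^2$ is the restriction to $\Sigma_2$ of the linear map $$\tilde{\beta}\begin{pmatrix} a_{11} & a_{12} \\ a_{21} & a_{22}\end{pmatrix} := \begin{pmatrix} 2 a_{11} + a_{21} & a_{12} - a_{11} + (a_{22} - a_{21})/2 \\ a_{21} & (a_{22} - a_{21})/2\end{pmatrix}$$ (which maps $\Sigma_2$ onto $\Sigma^2$), and $\delta$ is the main-diagonal flip $\delta\begin{pmatrix}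 b_{11} & b_{12} \\ b_{21} & b_{22}\end{pmatrix} := \begin{pmatrix} b_{22} & b_{12} \\ b_{21} & b_{11}\end{pmatrix}$, which exchanges $\Sigma^2$ and $\Sigma_2$. -}

module Defs where

open import Data.Nat using (ℕ; _+_; _*_; _∸_)
open import Data.Nat.DivMod using (_/_)
open import Data.Product using (∃; _×_)
open import Relation.Binary.PropositionalEquality using (_≡_)

record Mat : Set where
  constructor mat
  field
    a11 a12 a21 a22 : ℕ
open Mat public

infixl 7 _·_
_·_ : Mat → Mat → Mat
mat a b c d · mat e f g h = mat (a * e + b * g) (a * f + b * h) (c * e + d * g) (c * f + d * h)

R : Mat
R = mat 1 1 0 1

InΣ² : Mat → Set
InΣ² A = ∃ λ b11 → ∃ λ b12 → ∃ λ b21 → ∃ λ b22 →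
  (2 * b11 * b22 ≡ b12 * b21 + 1) × (A ≡ R · mat (2 * b11) b12 b21 b22)

InΣ₂ : Mat → Set
InΣ₂ A = ∃ λ b11 → ∃ λ b12 → ∃ λ b21 → ∃ λ b22 →
  (2 * b11 * b22 ≡ b12 * b21 + 1) × (A ≡ mat b11 b12 b21 (2 * b22) · R)

-- the linear map β̃ (truncated subtraction and floor division by 2 on ℕ;
-- these are exact on Σ_2, where a12 ≥ a11 and a22 - a21 is even and ≥ 0)
β̃ : Mat → Mat
β̃ (mat x11 x12 x21 x22) =
  mat (2 * x11 + x21) ((x12 ∸ x11) + (x22 ∸ x21) / 2) x21 ((x22 ∸ x21) / 2)

δ : Mat → Mat
δ (mat x11 x12 x21 x22) = mat x22 x12 x21 x11

-- On Σ₂ every matrix has the shape (a, b + a; c, 2d + c), and β̃ sends it to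
-- (2a + c, b + d; c, d).  Its flip δ is (d, b + d; c, 2a + c), again of that
-- shape with a and d exchanged, so β̃ sends it to (2d + c, b + a; c, a), which is
-- the flip of the original matrix.
module Submission where

open import Defs
open import Data.Nat using (_+_; _*_)
open import Data.Nat.DivMod using (_/_; m*n/n≡m)
open import Data.Nat.Properties using (*-comm; +-comm; m+n∸n≡m; +-identityʳ; *-identityʳ; *-zeroʳ)
open import Data.Product using (_,_)
open import Function using (_∘_)
open import Relation.Binary.PropositionalEquality using (_≡_; refl; cong; cong₂; trans; module ≡-Reasoning)

2*n/2≡n : ∀ n → 2 * n / 2 ≡ n
2*n/2≡n n = trans (cong (_/ 2) (*-comm 2 n)) (m*n/n≡m n 2)

·R-Σ₂-shape : ∀ a b c d → mat a b c (2 * d) · R ≡ mat a (b + a) c (2 * d + c)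
·R-Σ₂-shape a b c d
  rewrite *-identityʳ a | *-identityʳ b | *-zeroʳ b | *-identityʳ c
        | *-identityʳ (2 * d) | *-zeroʳ (2 * d) | +-identityʳ a | +-identityʳ c
        | +-comm a b | +-comm c (2 * d) = refl

β̃-Σ₂-shape : ∀ a b c d → β̃ (mat a (b + a) c (2 * d + c)) ≡ mat (2 * a + c) (b + d) c d
β̃-Σ₂-shape a b c d =
  cong₂ (λ x y → mat (2 * a + c) (x + y) c y)
        (m+n∸n≡m b a)
        (trans (cong (_/ 2) (m+n∸n≡m (2 * d) c)) (2*n/2≡n d))

proposition3 : (A : Mat) → InΣ₂ A → β̃ (δ (β̃ A)) ≡ δ A
proposition3 _ (a , b , c , d , _ , refl) = begin
  β̃ (δ (β̃ (mat a b c (2 * d) · R)))       ≡⟨ cong (β̃ ∘ δ ∘ β̃) (·R-Σ₂-shape a b c d) ⟩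
  β̃ (δ (β̃ (mat a (b + a) c (2 * d + c))))  ≡⟨ cong (β̃ ∘ δ) (β̃-Σ₂-shape a b c d) ⟩
  β̃ (mat d (b + d) c (2 * a + c))          ≡⟨ β̃-Σ₂-shape d b c a ⟩
  δ (mat a (b + a) c (2 * d + c))          ≡⟨ cong δ (·R-Σ₂-shape a b c d) ⟨
  δ (mat a b c (2 * d) · R)                ∎
  where open ≡-Reasoning
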